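{- For every $n\ge 1$, the complete graph $K_n$ satisfies $b^A_g(K_n)=b^I_g(K_n)=\lfloor n/2\rfloor$.
   Context: The balance game on a finite simple graph $G$ is played by two players, Admirable (A) and Impish (I), who alternately select a not-yet-labeled vertex of $G$ until all vertices are labeled; Admirable labels each vertex she selects by $0$ and Impish labels each vertex he selects by $1$. Each edge receives the sum modulo $2$ of the labels of its endpoints. Let $e_0$ and $e_1$ be the numbers of edges labeled $0$ and $1$ at the end; the discrepancy is $d=e_1-e_0$. Admirable tries to minimize $d$ and Impish tries to maximize $d$. $b^A_g(G)$ is the value of $d$ under optimal play of both players when Admirable moves first, and $b^I_g(G)$ is the value under optimal play when Impish moves first. -}

module Defs where

open import Data.Bool using (Bool; true; false; not; if_then_else_; _xor_)
open import Data.Nat as ℕ using (ℕ; zero; suc)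
open import Data.Fin using (Fin; toℕ; _≟_)
open import Data.Integer using (ℤ; +_; -[1+_]; _+_; _⊓_; _⊔_)
open import Data.List using (List; []; _∷_; foldr; map; filter; concatMap; allFin)
open import Data.Maybe using (Maybe; just; nothing; is-nothing)
open import Data.Product using (_×_; _,_)
open import Data.Empty using (⊥-elim)
open import Relation.Nullary using (yes; no)
open import Relation.Nullary.Decidable using (⌊_⌋)
open import Relation.Binary.PropositionalEquality using (_≡_; refl; sym)

record SimpleGraph (n : ℕ) : Set where
  field
    Adj    : Fin n → Fin n → Bool
    Adj-sym    : ∀ i j → Adj i j ≡ Adj j i
    Adj-irrefl : ∀ i → Adj i i ≡ false

open SimpleGraph public

K-adj : {n : ℕ} → Fin n → Fin n → Bool
K-adj i j = not ⌊ i ≟ j ⌋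

K-sym : {n : ℕ} (i j : Fin n) → K-adj i j ≡ K-adj j i
K-sym i j with i ≟ j | j ≟ i
... | yes _ | yes _ = refl
... | no _  | no _  = refl
... | yes p | no ¬q = ⊥-elim (¬q (sym p))
... | no ¬p | yes q = ⊥-elim (¬p (sym q))

K-irrefl : {n : ℕ} (i : Fin n) → K-adj i i ≡ false
K-irrefl i with i ≟ i
... | yes _ = refl
... | no ¬p = ⊥-elim (¬p refl)

K : (n : ℕ) → SimpleGraph n
K n = record { Adj = K-adj ; Adj-sym = K-sym ; Adj-irrefl = K-irrefl }

-- A (partial) labelling: nothing = not yet labelled, just false = label 0,
-- just true = label 1.
Labelling : ℕ → Set
Labelling n = Fin n → Maybe Bool

emptyLabelling : {n : ℕ} → Labelling n
emptyLabelling _ = nothing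

sumℤ : List ℤ → ℤ
sumℤ = foldr _+_ (+ 0)

pairs : (n : ℕ) → List (Fin n × Fin n)
pairs n = concatMap (λ i → map (λ j → (i , j)) (filter (λ j → toℕ i ℕ.<? toℕ j) (allFin n))) (allFin n)

-- Contribution of a pair to the discrepancy e₁ - e₀: non-edges contribute 0,
-- an edge with both ends labelled gets label (a + b mod 2) and contributes
-- +1 if that is 1 and -1 if it is 0.
pairContribution : Bool → Maybe Bool → Maybe Bool → ℤ
pairContribution false _ _ = + 0
pairContribution true (just a) (just b) = if a xor b then + 1 else -[1+ 0 ]
pairContribution true _ _ = + 0

discrepancy : {n : ℕ} → SimpleGraph n → Labelling n → ℤ
discrepancy {n} G f = sumℤ (map (λ { (i , j) → pairContribution (Adj G i j) (f i) (f j) }) (pairs n))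

unlabelled : {n : ℕ} → Labelling n → List (Fin n)
unlabelled {n} f = filter (λ i → Data.Bool._≟_ (is-nothing (f i)) true) (allFin n)
  where import Data.Bool

setLabel : {n : ℕ} → Labelling n → Fin n → Bool → Labelling n
setLabel f i b j with i ≟ j
... | yes _ = just b
... | no _  = f j

data Player : Set where
  Admirable Impish : Player

other : Player → Player
other Admirable = Impish
other Impish = Admirable

labelOf : Player → Bool
labelOf Admirable = false
labelOf Impish = true

combine : Player → ℤ → ℤ → ℤ
combine Admirable = _⊓_
combine Impish = _⊔_

optimum : Player → ℤ → List ℤ → ℤ
optimum p x xs = foldr (combine p) x xs

-- Minimax value of the position (labelling f, player p to move), with a
-- fuel parameter bounding the number of remaining moves.  Each move labels one vertex, so
-- fuel ≥ number of unlabelled vertices never runs out before the end.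
value : {n : ℕ} → SimpleGraph n → ℕ → Player → Labelling n → ℤ
value G fuel p f with unlabelled f
value G fuel       p f | [] = discrepancy G f
value G zero       p f | (_ ∷ _) = discrepancy G f  -- unreachable from the start position
value G (suc fuel) p f | (v ∷ vs) =
  optimum p (next v) (map next vs)
  where
  next : _ → ℤ
  next u = value G fuel (other p) (setLabel f u (labelOf p))

bA : {n : ℕ} → SimpleGraph n → ℤ
bA {n} G = value G n Admirable emptyLabelling

bI : {n : ℕ} → SimpleGraph n → ℤ
bI {n} G = value G n Impish emptyLabelling

{-# OPTIONS --safe #-}
module Submission where

open import Defs
open import Data.Nat using (ℕ; _≤_; _/_)
open import Data.Integer using (ℤ; +_)
open import Data.Product using (_×_)
open import Relation.Binary.PropositionalEquality using (_≡_)

open import Algebra.Bundles using (CommutativeMonoid)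
import Algebra.Properties.CommutativeMonoid.Sum as MonoidSum
open import Data.Bool using (Bool; true; false; if_then_else_) renaming (_≟_ to _≟ᵇ_)
open import Data.Fin using (Fin; zero; suc; toℕ; _≟_)
open import Data.Fin.Properties using (<⇒≢; punchInᵢ≢i)
open import Data.Integer using (-[1+_]; 0ℤ; _+_; _*_; -_; _-_)
open import Data.Integer.Properties
  using (+-*-semiring; +-0-commutativeMonoid; +-assoc; +-identityˡ; +-identityʳ;
         neg-distribˡ-*; *-cancelˡ-≡; ⊓-idem; ⊔-idem)
open import Algebra.Properties.Semiring.Sum +-*-semiring
  using (sum; sum-syntax; sum-cong-≗; sum-replicate-zero; *-distribˡ-sum)
open import Data.Integer.Tactic.RingSolver using (solve-∀)
open import Data.List using (List; []; _∷_; _++_; map; filter; concatMap; tabulate; allFin)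
open import Data.List.Properties using (map-∘)
open import Data.List.Membership.Propositional using (_∈_)
open import Data.List.Membership.Propositional.Properties using (∈-filter⁺; ∈-allFin)
open import Data.List.Relation.Unary.All using (All; []; _∷_) renaming (map to All-map)
import Data.List.Relation.Unary.All as All
open import Data.List.Relation.Unary.All.Properties using (all-filter; map⁺)
open import Data.Maybe using (Maybe; just; nothing; is-nothing; Is-just)
import Data.Maybe.Relation.Unary.Any as Any
import Data.Nat as ℕ
import Data.Nat.Properties as ℕₚ
open import Data.Nat.DivMod using (m/n≡1+[m∸n]/n)
open import Data.Product using (_,_)
open import Data.Unit using (tt)
open import Data.Vec.Functional using (removeAt)
open import Function using (_∘_)
open import Relation.Nullary using (Dec; does; yes; no; contradiction)
open import Relation.Unary using (Decidable)
open import Relation.Binary.PropositionalEquality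
  using (refl; sym; trans; cong; cong₂; subst; _≢_; module ≡-Reasoning)

-- Give label 1 the sign +1 and label 0 the sign −1, and let S be the sign sum of a complete
-- labelling.  An edge ij of K_n contributes −sᵢsⱼ to the discrepancy, so
-- 2d = −2 ∑_{i<j} sᵢsⱼ = n − S².  The players alternate, so the number of vertices that end
-- up labelled 1, hence S, hence d, is the same for every play: S = 0 for even n and S = ±1
-- for odd n.  Every play therefore ends with d = ⌊n/2⌋, and so does the minimax value.

setLabel-same : ∀ {n} (f : Labelling n) (u : Fin n) (b : Bool) → setLabel f u b u ≡ just b
setLabel-same f u b with u ≟ u
... | yes _   = refl
... | no u≢u = contradiction refl u≢u

setLabel-other : ∀ {n} (f : Labelling n) {u j : Fin n} (b : Bool) → u ≢ j → setLabel f u b j ≡ f j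
setLabel-other f {u} {j} b u≢j with u ≟ j
... | yes u≡j = contradiction u≡j u≢j
... | no _    = refl

module _ {c ℓ} (M : CommutativeMonoid c ℓ) where
  open CommutativeMonoid M using (Carrier; _≈_; _∙_; setoid; ∙-congˡ; ∙-congʳ; assoc; comm)
  open MonoidSum M using () renaming (sum to ∑; sum-remove to ∑-remove; sum-cong-≗ to ∑-cong-≗)
  open import Relation.Binary.Reasoning.Setoid setoid

  sum-setLabel : ∀ {n} (w : Maybe Bool → Carrier) (f : Labelling n) (u : Fin n) (b : Bool) →
                 ∑ (w ∘ setLabel f u b) ∙ w (f u) ≈ w (just b) ∙ ∑ (w ∘ f)
  sum-setLabel {ℕ.suc n} w f u b = begin
    ∑ (w ∘ f′) ∙ w (f u)                            ≈⟨ ∙-congʳ (∑-remove {i = u} (w ∘ f′)) ⟩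
    (w (f′ u) ∙ ∑ (removeAt (w ∘ f′) u)) ∙ w (f u)  ≡⟨ cong₂ (λ x r → (w x ∙ r) ∙ w (f u))
                                                             (setLabel-same f u b) rest ⟩
    (w (just b) ∙ R) ∙ w (f u)                      ≈⟨ assoc _ _ _ ⟩
    w (just b) ∙ (R ∙ w (f u))                      ≈⟨ ∙-congˡ (comm _ _) ⟩
    w (just b) ∙ (w (f u) ∙ R)                      ≈⟨ ∙-congˡ (∑-remove {i = u} (w ∘ f)) ⟨
    w (just b) ∙ ∑ (w ∘ f)                          ∎
    where
    f′ = setLabel f u b
    R  = ∑ (removeAt (w ∘ f) u)
    rest : ∑ (removeAt (w ∘ f′) u) ≡ R
    rest = ∑-cong-≗ (λ j → cong w (setLabel-other f b (punchInᵢ≢i u j ∘ sym)))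

sign : Maybe Bool → ℤ
sign (just true)  = + 1
sign (just false) = -[1+ 0 ]
sign nothing      = 0ℤ

hole : Maybe Bool → ℕ
hole (just _) = 0
hole nothing  = 1

signSum : ∀ {n} → Labelling n → ℤ
signSum f = sum (sign ∘ f)

holes : ∀ {n} → Labelling n → ℕ
holes f = MonoidSum.sum ℕₚ.+-0-commutativeMonoid (hole ∘ f)

Complete : ∀ {n} → Labelling n → Set
Complete f = ∀ i → Is-just (f i)

signSum-setLabel : ∀ {n} (f : Labelling n) {u : Fin n} (b : Bool) → f u ≡ nothing →
                   signSum (setLabel f u b) ≡ sign (just b) + signSum f
signSum-setLabel f {u} b u-free = begin
  signSum f′                    ≡⟨ +-identityʳ (signSum f′) ⟨
  signSum f′ + sign nothing     ≡⟨ cong (λ x → signSum f′ + sign x) u-free ⟨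
  signSum f′ + sign (f u)       ≡⟨ sum-setLabel +-0-commutativeMonoid sign f u b ⟩
  sign (just b) + signSum f     ∎
  where
  open ≡-Reasoning
  f′ = setLabel f u b

holes-setLabel : ∀ {n} (f : Labelling n) {u : Fin n} (b : Bool) → f u ≡ nothing →
                 holes f ≡ ℕ.suc (holes (setLabel f u b))
holes-setLabel f {u} b u-free = begin
  holes f                       ≡⟨ sum-setLabel ℕₚ.+-0-commutativeMonoid hole f u b ⟨
  holes f′ ℕ.+ hole (f u)       ≡⟨ cong (λ x → holes f′ ℕ.+ hole x) u-free ⟩
  holes f′ ℕ.+ 1                ≡⟨ ℕₚ.+-comm (holes f′) 1 ⟩
  ℕ.suc (holes f′)              ∎
  where
  open ≡-Reasoning
  f′ = setLabel f u b

holes-complete : ∀ {n} (f : Labelling n) → Complete f → holes f ≡ 0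
holes-complete {ℕ.zero}  f c = refl
holes-complete {ℕ.suc n} f c with f zero | c zero
... | just _ | _ = holes-complete (f ∘ suc) (c ∘ suc)

holes-empty : ∀ {n} → holes (emptyLabelling {n}) ≡ n
holes-empty {ℕ.zero}  = refl
holes-empty {ℕ.suc n} = cong ℕ.suc (holes-empty {n})

sumℤ-map-++ : {A : Set} (g : A → ℤ) (xs ys : List A) →
              sumℤ (map g (xs ++ ys)) ≡ sumℤ (map g xs) + sumℤ (map g ys)
sumℤ-map-++ g []       ys = sym (+-identityˡ _)
sumℤ-map-++ g (x ∷ xs) ys = trans (cong (_+_ (g x)) (sumℤ-map-++ g xs ys)) (sym (+-assoc (g x) _ _))

sumℤ-map-concatMap : {A B : Set} (g : B → ℤ) (F : A → List B) (xs : List A) →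
                     sumℤ (map g (concatMap F xs)) ≡ sumℤ (map (λ x → sumℤ (map g (F x))) xs)
sumℤ-map-concatMap g F []       = refl
sumℤ-map-concatMap g F (x ∷ xs) = trans (sumℤ-map-++ g (F x) (concatMap F xs))
                                        (cong (_+_ (sumℤ (map g (F x)))) (sumℤ-map-concatMap g F xs))

sumℤ-map-filter : {A : Set} {P : A → Set} (P? : Decidable P) (g : A → ℤ) (xs : List A) →
                  sumℤ (map g (filter P? xs)) ≡ sumℤ (map (λ x → if does (P? x) then g x else 0ℤ) xs)
sumℤ-map-filter P? g []       = refl
sumℤ-map-filter P? g (x ∷ xs) with does (P? x)
... | true  = cong (_+_ (g x)) (sumℤ-map-filter P? g xs)
... | false = trans (sumℤ-map-filter P? g xs) (sym (+-identityˡ _))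

sumℤ-map-tabulate : {A : Set} {n : ℕ} (g : A → ℤ) (t : Fin n → A) →
                    sumℤ (map g (tabulate t)) ≡ sum (g ∘ t)
sumℤ-map-tabulate {n = ℕ.zero}  g t = refl
sumℤ-map-tabulate {n = ℕ.suc n} g t = cong (_+_ (g (t zero))) (sumℤ-map-tabulate g (t ∘ suc))

if-does-cong : {A : Set} (a? : Dec A) {x y z : ℤ} → (A → x ≡ y) →
               (if does a? then x else z) ≡ (if does a? then y else z)
if-does-cong (yes a) x≡y = x≡y a
if-does-cong (no _)  _   = refl

ifLess : ∀ {n} → Fin n → Fin n → ℤ → ℤ
ifLess i j x = if does (toℕ i ℕ.<? toℕ j) then x else 0ℤ

upperSum : ∀ {n} → (Fin n → Fin n → ℤ) → ℤ
upperSum {n} g = ∑[ i < n ] ∑[ j < n ] ifLess i j (g i j)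

upperSum-suc : ∀ {n} (g : Fin (ℕ.suc n) → Fin (ℕ.suc n) → ℤ) →
               upperSum g ≡ ∑[ j < n ] g zero (suc j) + upperSum (λ i j → g (suc i) (suc j))
upperSum-suc {n} g =
  cong₂ _+_ (+-identityˡ (∑[ j < n ] g zero (suc j)))
            (sum-cong-≗ {n} (λ i → +-identityˡ (∑[ j < n ] ifLess i j (g (suc i) (suc j)))))

sumℤ-pairs : ∀ {n} (g : Fin n × Fin n → ℤ) → sumℤ (map g (pairs n)) ≡ upperSum (λ i j → g (i , j))
sumℤ-pairs {n} g = begin
  sumℤ (map g (pairs n))                              ≡⟨ sumℤ-map-concatMap g row (allFin n) ⟩
  sumℤ (map (λ i → sumℤ (map g (row i))) (allFin n))  ≡⟨ sumℤ-map-tabulate (λ i → sumℤ (map g (row i)))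
                                                                           (λ i → i) ⟩
  ∑[ i < n ] sumℤ (map g (row i))                     ≡⟨ sum-cong-≗ rowSum ⟩
  upperSum (λ i j → g (i , j))                        ∎
  where
  open ≡-Reasoning
  later : Fin n → List (Fin n)
  later i = filter (λ j → toℕ i ℕ.<? toℕ j) (allFin n)
  row : Fin n → List (Fin n × Fin n)
  row i = map (i ,_) (later i)
  rowSum : ∀ i → sumℤ (map g (row i)) ≡ ∑[ j < n ] ifLess i j (g (i , j))
  rowSum i = begin
    sumℤ (map g (row i))                                  ≡⟨ cong sumℤ (map-∘ {g = g} (later i)) ⟨
    sumℤ (map (g ∘ (i ,_)) (later i))                     ≡⟨ sumℤ-map-filter (λ j → toℕ i ℕ.<? toℕ j)
                                                                              (g ∘ (i ,_)) (allFin n) ⟩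
    sumℤ (map (λ j → ifLess i j (g (i , j))) (allFin n))  ≡⟨ sumℤ-map-tabulate (λ j → ifLess i j (g (i , j)))
                                                                                (λ j → j) ⟩
    ∑[ j < n ] ifLess i j (g (i , j))                     ∎

sum-square-expansion : ∀ {n} (x : Fin n → ℤ) → let D = upperSum (λ i j → - (x i * x j)) in
                       D + D + sum x * sum x ≡ ∑[ i < n ] (x i * x i)
sum-square-expansion {ℕ.zero}  x = refl
sum-square-expansion {ℕ.suc n} x = begin
  D + D + (x₀ + T) * (x₀ + T)                      ≡⟨ cong (λ e → e + e + (x₀ + T) * (x₀ + T)) D-suc ⟩
  (- (x₀ * T) + D′) + (- (x₀ * T) + D′) + (x₀ + T) * (x₀ + T)
                                                   ≡⟨ regroup x₀ T D′ ⟩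
  x₀ * x₀ + (D′ + D′ + T * T)                      ≡⟨ cong (_+_ (x₀ * x₀)) (sum-square-expansion (x ∘ suc)) ⟩
  ∑[ i < ℕ.suc n ] (x i * x i)                     ∎
  where
  open ≡-Reasoning
  x₀ = x zero
  T  = sum (x ∘ suc)
  D  = upperSum (λ i j → - (x i * x j))
  D′ = upperSum (λ i j → - (x (suc i) * x (suc j)))
  firstRow : ∑[ j < n ] (- (x₀ * x (suc j))) ≡ - (x₀ * T)
  firstRow = begin
    ∑[ j < n ] (- (x₀ * x (suc j)))  ≡⟨ sum-cong-≗ (λ j → neg-distribˡ-* x₀ (x (suc j))) ⟩
    ∑[ j < n ] (- x₀ * x (suc j))    ≡⟨ *-distribˡ-sum (- x₀) (x ∘ suc) ⟨
    - x₀ * T                         ≡⟨ neg-distribˡ-* x₀ T ⟨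
    - (x₀ * T)                       ∎
  D-suc : D ≡ - (x₀ * T) + D′
  D-suc = trans (upperSum-suc (λ i j → - (x i * x j))) (cong (_+ D′) firstRow)
  regroup : ∀ a t e → (- (a * t) + e) + (- (a * t) + e) + (a + t) * (a + t) ≡ a * a + (e + e + t * t)
  regroup = solve-∀

K-adj-distinct : ∀ {n} {i j : Fin n} → i ≢ j → K-adj i j ≡ true
K-adj-distinct {i = i} {j} i≢j with i ≟ j
... | yes i≡j = contradiction i≡j i≢j
... | no _    = refl

pairContribution-signs : {a b : Maybe Bool} → Is-just a → Is-just b →
                         pairContribution true a b ≡ - (sign a * sign b)
pairContribution-signs {just true}  {just true}  _ _ = refl
pairContribution-signs {just true}  {just false} _ _ = refl
pairContribution-signs {just false} {just true}  _ _ = refl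
pairContribution-signs {just false} {just false} _ _ = refl

sign-square : {a : Maybe Bool} → Is-just a → sign a * sign a ≡ + 1
sign-square {just true}  _ = refl
sign-square {just false} _ = refl

sum-sign-squares : ∀ {n} (f : Labelling n) → Complete f → ∑[ i < n ] (sign (f i) * sign (f i)) ≡ + n
sum-sign-squares {ℕ.zero}  f c = refl
sum-sign-squares {ℕ.suc n} f c = cong₂ _+_ (sign-square (c zero)) (sum-sign-squares (f ∘ suc) (c ∘ suc))

discrepancy-K : ∀ {n} (f : Labelling n) → Complete f →
                discrepancy (K n) f ≡ upperSum (λ i j → - (sign (f i) * sign (f j)))
discrepancy-K {n} f c = trans (sumℤ-pairs {n} _) (sum-cong-≗ λ i → sum-cong-≗ λ j →
  if-does-cong (toℕ i ℕ.<? toℕ j) λ i<j → trans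
    (cong (λ e → pairContribution e (f i) (f j)) (K-adj-distinct (<⇒≢ i<j)))
    (pairContribution-signs (c i) (c j)))

discrepancy-K-signSum : ∀ {n} (f : Labelling n) → Complete f → let d = discrepancy (K n) f in
                        d + d + signSum f * signSum f ≡ + n
discrepancy-K-signSum {n} f c = begin
  d + d + S * S                        ≡⟨ cong (λ e → e + e + S * S) (discrepancy-K f c) ⟩
  D + D + S * S                        ≡⟨ sum-square-expansion (sign ∘ f) ⟩
  ∑[ i < n ] (sign (f i) * sign (f i)) ≡⟨ sum-sign-squares f c ⟩
  + n                                  ∎
  where
  open ≡-Reasoning
  d = discrepancy (K n) f
  S = signSum f
  D = upperSum (λ i j → - (sign (f i) * sign (f j)))

double-cancelʳ : ∀ x y z → x + x + z ≡ y + y + z → x ≡ y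
double-cancelʳ x y z eq = *-cancelˡ-≡ (+ 2) x y (begin
  + 2 * x        ≡⟨ twice x z ⟩
  x + x + z - z  ≡⟨ cong (_- z) eq ⟩
  y + y + z - z  ≡⟨ twice y z ⟨
  + 2 * y        ∎)
  where
  open ≡-Reasoning
  twice : ∀ a c → + 2 * a ≡ a + a + c - c
  twice = solve-∀

discrepancy-K-determined : ∀ {n} (f : Labelling n) {d : ℤ} → Complete f →
                           d + d + signSum f * signSum f ≡ + n → discrepancy (K n) f ≡ d
discrepancy-K-determined f {d} c eq =
  double-cancelʳ _ d (signSum f * signSum f) (trans (discrepancy-K-signSum f c) (sym eq))

unlabelled-nothing : ∀ {n} (f : Labelling n) → All (λ u → f u ≡ nothing) (unlabelled f)
unlabelled-nothing {n} f = All-map (λ {u} → is-nothing⇒nothing (f u)) (all-filter _ (allFin n))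
  where
  is-nothing⇒nothing : (a : Maybe Bool) → is-nothing a ≡ true → a ≡ nothing
  is-nothing⇒nothing nothing _ = refl

unlabelled-[]⇒complete : ∀ {n} (f : Labelling n) → unlabelled f ≡ [] → Complete f
unlabelled-[]⇒complete {n} f none i with f i in fi
... | just _  = Any.just tt
... | nothing = contradiction
  (subst (i ∈_) none (∈-filter⁺ (λ j → is-nothing (f j) ≟ᵇ true) (∈-allFin i) (cong is-nothing fi)))
  λ ()

combine-idem : ∀ p x → combine p x x ≡ x
combine-idem Admirable = ⊓-idem
combine-idem Impish    = ⊔-idem

optimum-const : ∀ p {x d : ℤ} {xs} → x ≡ d → All (_≡ d) xs → optimum p x xs ≡ d
optimum-const p x≡d []            = x≡d
optimum-const p x≡d (refl ∷ xs≡d) =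
  trans (cong (combine p _) (optimum-const p x≡d xs≡d)) (combine-idem p _)

module _ {n} (G : SimpleGraph n) (d : ℤ) (Inv : Player → Labelling n → Set)
  (Inv-move : ∀ {p f u} → Inv p f → f u ≡ nothing → Inv (other p) (setLabel f u (labelOf p)))
  (Inv-end : ∀ {p f} → Inv p f → Complete f → discrepancy G f ≡ d)
  where

  value-invariant : ∀ fuel p f → holes f ≤ fuel → Inv p f → value G fuel p f ≡ d
  value-invariant fuel p f holes≤fuel inv with unlabelled f in e | fuel
  ... | []     | _           = Inv-end inv (unlabelled-[]⇒complete f e)
  ... | v ∷ vs | ℕ.zero      =
    contradiction (subst (_≤ 0) (holes-setLabel f (labelOf p) (All.head free)) holes≤fuel) λ ()
    where free = subst (All _) e (unlabelled-nothing f)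
  ... | v ∷ vs | ℕ.suc fuel′ = optimum-const p (All.head moves) (map⁺ (All.tail moves))
    where
    move : ∀ {u} → f u ≡ nothing → value G fuel′ (other p) (setLabel f u (labelOf p)) ≡ d
    move u-free = value-invariant fuel′ (other p) _
      (ℕₚ.≤-pred (subst (_≤ ℕ.suc fuel′) (holes-setLabel f (labelOf p) u-free) holes≤fuel))
      (Inv-move inv u-free)
    moves : All (λ u → value G fuel′ (other p) (setLabel f u (labelOf p)) ≡ d) (v ∷ vs)
    moves = All-map move (subst (All _) e (unlabelled-nothing f))

alternatingSum : ℕ → Player → ℤ
alternatingSum ℕ.zero    p = 0ℤ
alternatingSum (ℕ.suc k) p = sign (just (labelOf p)) + alternatingSum k (other p)

alternatingSum-period : ∀ k p → alternatingSum (ℕ.suc (ℕ.suc k)) p ≡ alternatingSum k p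
alternatingSum-period k Admirable = trans (sym (+-assoc -[1+ 0 ] (+ 1) a)) (+-identityˡ a)
  where a = alternatingSum k Admirable
alternatingSum-period k Impish    = trans (sym (+-assoc (+ 1) -[1+ 0 ] a)) (+-identityˡ a)
  where a = alternatingSum k Impish

alternatingSum-square : ∀ n p → + (n / 2) + + (n / 2) + alternatingSum n p * alternatingSum n p ≡ + n
alternatingSum-square 0 p = refl
alternatingSum-square 1 Admirable = refl
alternatingSum-square 1 Impish    = refl
alternatingSum-square (ℕ.suc (ℕ.suc k)) p = begin
  + h + + h + a₂ * a₂                  ≡⟨ cong (λ m → + m + + m + a₂ * a₂) h≡1+k/2 ⟩
  + (1 ℕ.+ h′) + + (1 ℕ.+ h′) + a₂ * a₂ ≡⟨ cong (λ x → + (1 ℕ.+ h′) + + (1 ℕ.+ h′) + x * x)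
                                               (alternatingSum-period k p) ⟩
  + (1 ℕ.+ h′) + + (1 ℕ.+ h′) + a * a   ≡⟨ shift (+ h′) (a * a) ⟩
  + 2 + (+ h′ + + h′ + a * a)           ≡⟨ cong (_+_ (+ 2)) (alternatingSum-square k p) ⟩
  + (2 ℕ.+ k)                           ∎
  where
  open ≡-Reasoning
  h  = (2 ℕ.+ k) / 2
  h′ = k / 2
  a₂ = alternatingSum (2 ℕ.+ k) p
  a  = alternatingSum k p
  h≡1+k/2 : h ≡ 1 ℕ.+ h′
  h≡1+k/2 = m/n≡1+[m∸n]/n {2 ℕ.+ k} {2} (ℕ.s≤s (ℕ.s≤s ℕ.z≤n))
  shift : ∀ m s → (+ 1 + m) + (+ 1 + m) + s ≡ + 2 + (m + m + s)
  shift = solve-∀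

-- The sign sum every play from position (p, f) ends with: the holes are filled alternately,
-- starting with p.
finalSignSum : ∀ {n} → Player → Labelling n → ℤ
finalSignSum p f = signSum f + alternatingSum (holes f) p

finalSignSum-setLabel : ∀ {n} p (f : Labelling n) {u : Fin n} → f u ≡ nothing →
                        finalSignSum (other p) (setLabel f u (labelOf p)) ≡ finalSignSum p f
finalSignSum-setLabel p f {u} u-free = begin
  signSum f′ + alternatingSum (holes f′) (other p)
    ≡⟨ cong (_+ alternatingSum (holes f′) (other p)) (signSum-setLabel f (labelOf p) u-free) ⟩
  sign (just (labelOf p)) + signSum f + alternatingSum (holes f′) (other p)
    ≡⟨ swap (sign (just (labelOf p))) (signSum f) (alternatingSum (holes f′) (other p)) ⟩
  signSum f + alternatingSum (ℕ.suc (holes f′)) p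
    ≡⟨ cong (λ k → signSum f + alternatingSum k p) (holes-setLabel f (labelOf p) u-free) ⟨
  signSum f + alternatingSum (holes f) p
    ∎
  where
  open ≡-Reasoning
  f′ = setLabel f u (labelOf p)
  swap : ∀ a s w → a + s + w ≡ s + (a + w)
  swap = solve-∀

finalSignSum-complete : ∀ {n} p (f : Labelling n) → Complete f → finalSignSum p f ≡ signSum f
finalSignSum-complete p f c =
  trans (cong (λ k → signSum f + alternatingSum k p) (holes-complete f c)) (+-identityʳ (signSum f))

finalSignSum-empty : ∀ n p → finalSignSum p (emptyLabelling {n}) ≡ alternatingSum n p
finalSignSum-empty n p =
  trans (cong₂ (λ s k → s + alternatingSum k p) (sum-replicate-zero n) (holes-empty {n}))
        (+-identityˡ (alternatingSum n p))

value-K : ∀ {n} fuel p (f : Labelling n) {d : ℤ} → holes f ≤ fuel →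
          d + d + finalSignSum p f * finalSignSum p f ≡ + n → value (K n) fuel p f ≡ d
value-K {n} fuel p f {d} holes≤fuel eq =
  value-invariant (K n) d (λ q g → finalSignSum q g ≡ finalSignSum p f)
    (λ {q} {g} inv u-free → trans (finalSignSum-setLabel q g u-free) inv)
    (λ {q} {g} inv c → discrepancy-K-determined g c
      (subst (λ s → d + d + s * s ≡ + n) (trans (sym inv) (finalSignSum-complete q g c)) eq))
    fuel p f holes≤fuel refl

value-K-start : ∀ n p → value (K n) n p emptyLabelling ≡ + (n / 2)
value-K-start n p = value-K n p emptyLabelling (ℕₚ.≤-reflexive holes-empty)
  (subst (λ s → + (n / 2) + + (n / 2) + s * s ≡ + n) (sym (finalSignSum-empty n p))
         (alternatingSum-square n p))

proposition3p3 : (n : ℕ) → 1 ≤ n → (bA (K n) ≡ + (n / 2)) × (bI (K n) ≡ + (n / 2))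
proposition3p3 n _ = value-K-start n Admirable , value-K-start n Impish
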